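{- Let $n,k,t,s$ be positive integers with $k\geq t+1$ and $n\geq (t+1)(k-t+1)^{2}$. Suppose that $\mathcal{F},\mathcal{G}\subseteq\binom{[n]}{k}$ are non-empty $s$-almost cross-$t$-intersecting families with $\tau_t(\mathcal{G})\leq k$. If $H$ is a non-empty subset of $[n]$ with $|H|\leq\tau_t(\mathcal{G})$, then $$|\mathcal{F}_H|\leq (k-t+1)^{\tau_t(\mathcal{G})-|H|}\binom{n-\tau_t(\mathcal{G})}{k-\tau_t(\mathcal{G})}+\sum_{i=0}^{\tau_t(\mathcal{G})-|H|-1}s(k-t+1)^{i}.$$
   Context: $[n]=\{1,\dots,n\}$, $\binom{X}{k}$ is the family of $k$-subsets of $X$. Two sets are $t$-disjoint if they share fewer than $t$ elements. Families $\mathcal{F},\mathcal{G}$ are $s$-almost cross-$t$-intersecting if each member of $\mathcal{F}$ is $t$-disjoint with at most $s$ members of $\mathcal{G}$ and vice versa. For a family $\mathcal{F}$ and set $H$, $\mathcal{F}_H=\{F\in\mathcal{F}: H\subseteq F\}$. A $t$-cover of $\mathcal{G}$ is a set $T\subseteq[n]$ with $|T\cap G|\geq t$ for all $G\in\mathcal{G}$; $\tau_t(\mathcal{G})$ is the minimum size of a $t$-cover of $\mathcal{G}$. The paper assumes throughout that $s$-almost cross-$t$-intersecting families are non-empty. -}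

module Defs where

open import Data.Nat using (ℕ; _≤_; _<_; _<?_; _+_; _*_; _∸_; _^_)
open import Data.Fin.Subset using (Subset; _∩_; ∣_∣; _⊆_)
open import Data.Fin.Subset.Properties using (_⊆?_)
open import Data.List using (List; length; filter; map; upTo)
open import Data.Nat.ListAction using (sum)
open import Data.List.Relation.Unary.All using (All)
open import Data.List.Relation.Unary.Unique.Propositional using (Unique)
open import Data.Product using (Σ; _×_)
open import Relation.Binary.PropositionalEquality using (_≡_)

record Family (n : ℕ) : Set where
  constructor mkFamily
  field
    members  : List (Subset n)
    distinct : Unique members
open Family public

size : ∀ {n} → Family n → ℕ
size 𝓕 = length (members 𝓕)

Uniform : ∀ {n} → ℕ → Family n → Set
Uniform k 𝓕 = All (λ F → ∣ F ∣ ≡ k) (members 𝓕)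

sizeContaining : ∀ {n} → Family n → Subset n → ℕ
sizeContaining 𝓕 H = length (filter (λ F → H ⊆? F) (members 𝓕))

numTDisjoint : ∀ {n} → ℕ → Subset n → Family n → ℕ
numTDisjoint t A 𝓖 = length (filter (λ G → ∣ A ∩ G ∣ <? t) (members 𝓖))

AlmostCrossIntersecting : ∀ {n} → ℕ → ℕ → Family n → Family n → Set
AlmostCrossIntersecting s t 𝓕 𝓖 =
  All (λ F → numTDisjoint t F 𝓖 ≤ s) (members 𝓕) ×
  All (λ G → numTDisjoint t G 𝓕 ≤ s) (members 𝓖)

IsTCover : ∀ {n} → ℕ → Family n → Subset n → Set
IsTCover t 𝓖 T = All (λ G → t ≤ ∣ T ∩ G ∣) (members 𝓖)

IsTau : ∀ {n} → ℕ → Family n → ℕ → Set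
IsTau {n} t 𝓖 m =
  Σ (Subset n) (λ T → IsTCover t 𝓖 T × ∣ T ∣ ≡ m) ×
  ((T : Subset n) → IsTCover t 𝓖 T → m ≤ ∣ T ∣)

geomSum : ℕ → ℕ → ℕ → ℕ
geomSum s b m = sum (map (λ i → s * b ^ i) (upTo m))

{-# OPTIONS --safe #-}
module Submission where

-- Induction on τ − |H|. When |H| = τ ≤ k, the members of 𝓕 containing H are k-sets
-- through H, at most C(n − τ, k − τ) of them. When |H| < τ, H is no t-cover of 𝓖, so
-- some G ∈ 𝓖 has |H ∩ G| < t and therefore |G − H| ≥ k − t + 1; fix S ⊆ G − H with
-- |S| = k − t + 1. Of the members F ⊇ H, at most s are t-disjoint from G, and every
-- other one meets S (otherwise |F ∩ G| ≤ k − |S| = t − 1), so lies in some 𝓕_{H ∪ {x}}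
-- with x ∈ S. Hence |𝓕_H| ≤ s + (k − t + 1) · max_x |𝓕_{H ∪ {x}}|, which unrolls to
-- the bound.

open import Defs
open import Data.Nat
open import Data.Nat.Properties
open import Data.Nat.Combinatorics using (_C_; nCk+nC[k+1]≡[n+1]C[k+1])
open import Data.Nat.ListAction using (sum)
open import Data.Nat.Tactic.RingSolver using (solve-∀)
import Data.Bool as Bool
open import Data.Fin using (Fin; zero; suc)
open import Data.Fin.Subset
open import Data.Fin.Subset.Properties
open import Data.Vec using ([]; _∷_; here; there)
open import Data.List using (List; []; _∷_; length; filter; map; applyUpTo)
open import Data.List.Properties using (filter-none; length-map)
open import Data.List.Relation.Unary.All as All using (All; []; _∷_)
import Data.List.Relation.Unary.All.Properties as All
open import Data.List.Relation.Unary.All.Properties using (¬All⇒Any¬)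
open import Data.List.Relation.Unary.Any as Any using (Any; here; there)
import Data.List.Relation.Unary.Any.Properties as Any
open import Data.List.Relation.Unary.AllPairs using ([]; _∷_)
open import Data.List.Relation.Unary.Unique.Propositional using (Unique)
import Data.List.Relation.Unary.Unique.Propositional.Properties as Unique
open import Data.List.Relation.Binary.Sublist.Propositional using () renaming (⊆-refl to sublist-refl)
import Data.List.Relation.Binary.Sublist.Propositional.Properties as Sublist
open import Data.Product using (∃-syntax; _×_; _,_; proj₁; proj₂)
open import Data.Sum using (inj₁; inj₂)
open import Function using (_∘_; id)
open import Level using (0ℓ)
open import Relation.Nullary using (¬_; yes; no; contradiction; ¬?; _×-dec_)
open import Relation.Unary using (Pred; Decidable)
open import Relation.Unary.Properties using (∁?; _∩?_)
open import Relation.Binary.PropositionalEquality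

private
  variable
    n : ℕ

module _ {A : Set} where

  length-filter-mono : {P Q : Pred A 0ℓ} (P? : Decidable P) (Q? : Decidable Q) →
    (∀ {a} → P a → Q a) → ∀ as → length (filter P? as) ≤ length (filter Q? as)
  length-filter-mono P? Q? P⇒Q as =
    Sublist.length-mono-≤ (Sublist.filter⁺ P? Q? (λ { refl → P⇒Q }) (sublist-refl {x = as}))

  length-filter-split : {P Q : Pred A 0ℓ} (P? : Decidable P) (Q? : Decidable Q) → ∀ as →
    length (filter P? as) ≡ length (filter (P? ∩? Q?) as) + length (filter (P? ∩? ∁? Q?) as)
  length-filter-split P? Q? [] = refl
  length-filter-split P? Q? (a ∷ as) with P? a | Q? a
  ... | no _  | _     = length-filter-split P? Q? as
  ... | yes _ | yes _ = cong suc (length-filter-split P? Q? as)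
  ... | yes _ | no _  = trans (cong suc (length-filter-split P? Q? as)) (sym (+-suc _ _))

  length-filter-≤-cover : {B : Set} {P : Pred A 0ℓ} (P? : Decidable P)
    {_∼_ : B → A → Set} (∼? : ∀ b → Decidable (b ∼_)) {M : ℕ} (bs : List B) (as : List A) →
    (∀ {a} → P a → Any (_∼ a) bs) →
    All (λ b → length (filter (P? ∩? ∼? b) as) ≤ M) bs →
    length (filter P? as) ≤ length bs * M
  length-filter-≤-cover P? ∼? [] as cover [] =
    ≤-reflexive (cong length (filter-none P? {as} (All.tabulate (λ _ → Any.¬Any[] ∘ cover))))
  length-filter-≤-cover {P = P} P? {_∼_} ∼? {M} (b ∷ bs) as cover (count-b ∷ counts) = begin
    length (filter P? as)                                    ≡⟨ length-filter-split P? (∼? b) as ⟩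
    length (filter (P? ∩? ∼? b) as) + length (filter P′? as)
      ≤⟨ +-mono-≤ count-b (length-filter-≤-cover P′? ∼? bs as cover′ counts′) ⟩
    M + length bs * M                                        ∎
    where
      open ≤-Reasoning
      P′? = P? ∩? ∁? (∼? b)
      cover′ : ∀ {a} → P a × ¬ b ∼ a → Any (_∼ a) bs
      cover′ (p , b≁a) with cover p
      ... | here b∼a = contradiction b∼a b≁a
      ... | there i  = i
      counts′ : All (λ c → length (filter (P′? ∩? ∼? c) as) ≤ M) bs
      counts′ = All.map (≤-trans (length-filter-mono _ _ (λ ((p , _) , c∼a) → p , c∼a) as)) counts

  All-∅⇒length≡0 : {P : Pred A 0ℓ} → (∀ {a} → ¬ P a) → ∀ {as} → All P as → length as ≡ 0
  All-∅⇒length≡0 ¬P []       = refl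
  All-∅⇒length≡0 ¬P (Pa ∷ _) = contradiction Pa ¬P

∣p∣≡∣p∩q∣+∣p─q∣ : ∀ (p q : Subset n) → ∣ p ∣ ≡ ∣ p ∩ q ∣ + ∣ p ─ q ∣
∣p∣≡∣p∩q∣+∣p─q∣ []            []            = refl
∣p∣≡∣p∩q∣+∣p─q∣ (inside  ∷ p) (inside  ∷ q) = cong suc (∣p∣≡∣p∩q∣+∣p─q∣ p q)
∣p∣≡∣p∩q∣+∣p─q∣ (inside  ∷ p) (outside ∷ q) =
  trans (cong suc (∣p∣≡∣p∩q∣+∣p─q∣ p q)) (sym (+-suc _ _))
∣p∣≡∣p∩q∣+∣p─q∣ (outside ∷ p) (inside  ∷ q) = ∣p∣≡∣p∩q∣+∣p─q∣ p q
∣p∣≡∣p∩q∣+∣p─q∣ (outside ∷ p) (outside ∷ q) = ∣p∣≡∣p∩q∣+∣p─q∣ p q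

Empty[p∩q]⇒∣p∣+∣q∣≤∣r∣ : ∀ (p q r : Subset n) → p ⊆ r → q ⊆ r → Empty (p ∩ q) →
  ∣ p ∣ + ∣ q ∣ ≤ ∣ r ∣
Empty[p∩q]⇒∣p∣+∣q∣≤∣r∣ []            []            []            _   _   _     = z≤n
Empty[p∩q]⇒∣p∣+∣q∣≤∣r∣ (inside  ∷ p) (inside  ∷ q) _             _   _   empty = contradiction (zero , here) empty
Empty[p∩q]⇒∣p∣+∣q∣≤∣r∣ (inside  ∷ p) (outside ∷ q) (outside ∷ r) p⊆r _   _     = contradiction (p⊆r here) λ ()
Empty[p∩q]⇒∣p∣+∣q∣≤∣r∣ (outside ∷ p) (inside  ∷ q) (outside ∷ r) _   q⊆r _     = contradiction (q⊆r here) λ ()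
Empty[p∩q]⇒∣p∣+∣q∣≤∣r∣ (inside  ∷ p) (outside ∷ q) (inside  ∷ r) p⊆r q⊆r empty =
  s≤s (Empty[p∩q]⇒∣p∣+∣q∣≤∣r∣ p q r (drop-∷-⊆ p⊆r) (drop-∷-⊆ q⊆r) (drop-∷-Empty empty))
Empty[p∩q]⇒∣p∣+∣q∣≤∣r∣ (outside ∷ p) (inside  ∷ q) (inside  ∷ r) p⊆r q⊆r empty =
  subst (_≤ suc ∣ r ∣) (sym (+-suc ∣ p ∣ ∣ q ∣))
    (s≤s (Empty[p∩q]⇒∣p∣+∣q∣≤∣r∣ p q r (drop-∷-⊆ p⊆r) (drop-∷-⊆ q⊆r) (drop-∷-Empty empty)))
Empty[p∩q]⇒∣p∣+∣q∣≤∣r∣ (outside ∷ p) (outside ∷ q) (inside  ∷ r) p⊆r q⊆r empty =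
  m≤n⇒m≤1+n (Empty[p∩q]⇒∣p∣+∣q∣≤∣r∣ p q r (drop-∷-⊆ p⊆r) (drop-∷-⊆ q⊆r) (drop-∷-Empty empty))
Empty[p∩q]⇒∣p∣+∣q∣≤∣r∣ (outside ∷ p) (outside ∷ q) (outside ∷ r) p⊆r q⊆r empty =
  Empty[p∩q]⇒∣p∣+∣q∣≤∣r∣ p q r (drop-∷-⊆ p⊆r) (drop-∷-⊆ q⊆r) (drop-∷-Empty empty)

∃⊆-ofSize : ∀ (p : Subset n) {m} → m ≤ ∣ p ∣ → ∃[ q ] q ⊆ p × ∣ q ∣ ≡ m
∃⊆-ofSize []            z≤n   = [] , (λ ()) , refl
∃⊆-ofSize (outside ∷ p) m≤∣p∣ with ∃⊆-ofSize p m≤∣p∣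
... | q , q⊆p , ∣q∣≡m = outside ∷ q , s⊆s q⊆p , ∣q∣≡m
∃⊆-ofSize {suc n} (inside ∷ p) {zero} _ = ⊥ , ⊥⊆ , ∣⊥∣≡0 (suc n)
∃⊆-ofSize (inside ∷ p) {suc m} (s≤s m≤∣p∣) with ∃⊆-ofSize p m≤∣p∣
... | q , q⊆p , ∣q∣≡m = inside ∷ q , s⊆s q⊆p , cong suc ∣q∣≡m

x∈p─q⇒x∉q : ∀ (p q : Subset n) {x} → x ∈ p ─ q → x ∉ q
x∈p─q⇒x∉q (_ ∷ p) (outside ∷ q) here           ()
x∈p─q⇒x∉q (_ ∷ p) (_       ∷ q) (there x∈p─q) (there x∈q) = x∈p─q⇒x∉q p q x∈p─q x∈q

x∉p⇒∣p∪⁅x⁆∣≡1+∣p∣ : ∀ (p : Subset n) {x} → x ∉ p → ∣ p ∪ ⁅ x ⁆ ∣ ≡ suc ∣ p ∣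
x∉p⇒∣p∪⁅x⁆∣≡1+∣p∣ (inside  ∷ p) {x = zero}  x∉p = contradiction here x∉p
x∉p⇒∣p∪⁅x⁆∣≡1+∣p∣ (outside ∷ p) {x = zero}  _   = cong (suc ∘ ∣_∣) (∪-identityʳ p)
x∉p⇒∣p∪⁅x⁆∣≡1+∣p∣ (inside  ∷ p) {x = suc x} x∉p = cong suc (x∉p⇒∣p∪⁅x⁆∣≡1+∣p∣ p (x∉p ∘ there))
x∉p⇒∣p∪⁅x⁆∣≡1+∣p∣ (outside ∷ p) {x = suc x} x∉p = x∉p⇒∣p∪⁅x⁆∣≡1+∣p∣ p (x∉p ∘ there)

p⊆r∧x∈r⇒p∪⁅x⁆⊆r : ∀ {p r : Subset n} {x} → p ⊆ r → x ∈ r → p ∪ ⁅ x ⁆ ⊆ r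
p⊆r∧x∈r⇒p∪⁅x⁆⊆r {p = p} {r} {x} p⊆r x∈r y∈ with x∈p∪q⁻ p ⁅ x ⁆ y∈
... | inj₁ y∈p   = p⊆r y∈p
... | inj₂ y∈⁅x⁆ = subst (_∈ r) (sym (x∈⁅y⁆⇒x≡y x y∈⁅x⁆)) x∈r

elements : Subset n → List (Fin n)
elements []            = []
elements (inside  ∷ p) = zero ∷ map suc (elements p)
elements (outside ∷ p) = map suc (elements p)

length-elements : ∀ (p : Subset n) → length (elements p) ≡ ∣ p ∣
length-elements []            = refl
length-elements (inside  ∷ p) = cong suc (trans (length-map suc (elements p)) (length-elements p))
length-elements (outside ∷ p) = trans (length-map suc (elements p)) (length-elements p)

Any-elements⁺ : ∀ {P : Pred (Fin n) 0ℓ} {p x} → x ∈ p → P x → Any P (elements p)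
Any-elements⁺ {p = inside  ∷ p} here        Px = here Px
Any-elements⁺ {p = inside  ∷ p} (there x∈p) Px = there (Any.map⁺ (Any-elements⁺ x∈p Px))
Any-elements⁺ {p = outside ∷ p} (there x∈p) Px = Any.map⁺ (Any-elements⁺ x∈p Px)

All-elements⁺ : ∀ {P : Pred (Fin n) 0ℓ} (p : Subset n) → (∀ {x} → x ∈ p → P x) → All P (elements p)
All-elements⁺ []            _   = []
All-elements⁺ (inside  ∷ p) ∈⇒P = ∈⇒P here ∷ All.map⁺ (All-elements⁺ p (∈⇒P ∘ there))
All-elements⁺ (outside ∷ p) ∈⇒P = All.map⁺ (All-elements⁺ p (∈⇒P ∘ there))

tailsWith : Side → List (Subset (suc n)) → List (Subset n)
tailsWith s []            = []
tailsWith s ((x ∷ F) ∷ L) with x Bool.≟ s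
... | yes _ = F ∷ tailsWith s L
... | no  _ = tailsWith s L

length-tails : ∀ (L : List (Subset (suc n))) →
  length L ≡ length (tailsWith inside L) + length (tailsWith outside L)
length-tails []                  = refl
length-tails ((inside  ∷ F) ∷ L) = cong suc (length-tails L)
length-tails ((outside ∷ F) ∷ L) = trans (cong suc (length-tails L)) (sym (+-suc _ _))

All-tailsWith : ∀ {P : Pred (Subset (suc n)) 0ℓ} s {L} → All P L → All (P ∘ (s ∷_)) (tailsWith s L)
All-tailsWith s {[]}          []        = []
All-tailsWith s {(x ∷ F) ∷ L} (PF ∷ PL) with x Bool.≟ s
... | yes refl = PF ∷ All-tailsWith s PL
... | no  _    = All-tailsWith s PL

Unique-tailsWith : ∀ s {L : List (Subset (suc n))} → Unique L → Unique (tailsWith s L)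
Unique-tailsWith s {[]}          []          = []
Unique-tailsWith s {(x ∷ F) ∷ L} (F∉L ∷ uL) with x Bool.≟ s
... | yes refl = All.map (λ F≢G F≡G → F≢G (cong (x ∷_) F≡G)) (All-tailsWith s F∉L) ∷ Unique-tailsWith s uL
... | no  _    = Unique-tailsWith s uL

Superset : ℕ → Subset n → Subset n → Set
Superset k H F = ∣ F ∣ ≡ k × H ⊆ F

supersets-≤ : ∀ (H : Subset n) m {L} → Unique L → All (Superset (∣ H ∣ + m) H) L →
  length L ≤ (n ∸ ∣ H ∣) C m
tailsWith-≤ : ∀ {x} (H : Subset n) {k} m s {L} → Unique L → All (Superset k (x ∷ H)) L →
  (∀ {F} → ∣ s ∷ F ∣ ≡ k → ∣ F ∣ ≡ ∣ H ∣ + m) → length (tailsWith s L) ≤ (n ∸ ∣ H ∣) C m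

supersets-≤ [] m       {[]}          _             _              = z≤n
supersets-≤ [] zero    {[] ∷ []}     _             _              = ≤-refl
supersets-≤ [] zero    {[] ∷ [] ∷ _} ((≢ ∷ _) ∷ _) _              = contradiction refl ≢
supersets-≤ [] (suc m) {[] ∷ _}      _             ((() , _) ∷ _)
supersets-≤ {suc n} (inside ∷ H) m {L} uL supL = begin
  length L                                                   ≡⟨ length-tails L ⟩
  length (tailsWith inside L) + length (tailsWith outside L)
    ≡⟨ cong (length (tailsWith inside L) +_) none-outside ⟩
  length (tailsWith inside L) + 0                            ≡⟨ +-identityʳ _ ⟩
  length (tailsWith inside L)                                ≤⟨ tailsWith-≤ H m inside uL supL suc-injective ⟩
  (n ∸ ∣ H ∣) C m                                            ∎
  where
    open ≤-Reasoning
    none-outside : length (tailsWith outside L) ≡ 0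
    none-outside = All-∅⇒length≡0 (λ (_ , H⊆F) → contradiction (H⊆F here) λ ()) (All-tailsWith outside supL)
supersets-≤ {suc n} (outside ∷ H) zero {L} uL supL = begin
  length L                                                   ≡⟨ length-tails L ⟩
  length (tailsWith inside L) + length (tailsWith outside L)
    ≡⟨ cong (_+ length (tailsWith outside L)) none-inside ⟩
  length (tailsWith outside L)                               ≤⟨ tailsWith-≤ H zero outside uL supL id ⟩
  (n ∸ ∣ H ∣) C 0                                            ≡⟨⟩
  (suc n ∸ ∣ H ∣) C 0                                        ∎
  where
    open ≤-Reasoning
    none-inside : length (tailsWith inside L) ≡ 0
    none-inside = All-∅⇒length≡0
      (λ (∣F∣+1≡∣H∣+0 , H⊆F) →
        <⇒≱ (≤-reflexive (trans ∣F∣+1≡∣H∣+0 (+-identityʳ _))) (p⊆q⇒∣p∣≤∣q∣ (drop-∷-⊆ H⊆F)))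
      (All-tailsWith inside supL)
supersets-≤ {suc n} (outside ∷ H) (suc m) {L} uL supL = begin
  length L                                                   ≡⟨ length-tails L ⟩
  length (tailsWith inside L) + length (tailsWith outside L) ≤⟨ +-mono-≤
    (tailsWith-≤ H m inside uL supL (λ e → suc-injective (trans e (+-suc _ _))))
    (tailsWith-≤ H (suc m) outside uL supL id) ⟩
  (n ∸ ∣ H ∣) C m + (n ∸ ∣ H ∣) C suc m                      ≡⟨ nCk+nC[k+1]≡[n+1]C[k+1] (n ∸ ∣ H ∣) m ⟩
  suc (n ∸ ∣ H ∣) C suc m                                    ≡⟨ cong (_C suc m) (sym (+-∸-assoc 1 (∣p∣≤n H))) ⟩
  (suc n ∸ ∣ H ∣) C suc m                                    ∎
  where open ≤-Reasoning

tailsWith-≤ H m s uL supL ∣s∷F∣≡k⇒∣F∣≡ = supersets-≤ H m (Unique-tailsWith s uL)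
  (All.map (λ {F} (∣s∷F∣≡k , H⊆F) → ∣s∷F∣≡k⇒∣F∣≡ {F} ∣s∷F∣≡k , λ {_} → drop-∷-⊆ H⊆F) (All-tailsWith s supL))

sizeContaining-≤ : ∀ {k} (𝓕 : Family n) {H : Subset n} → Uniform k 𝓕 → ∣ H ∣ ≤ k →
  sizeContaining 𝓕 H ≤ (n ∸ ∣ H ∣) C (k ∸ ∣ H ∣)
sizeContaining-≤ 𝓕 {H} uF ∣H∣≤k = supersets-≤ H _ (Unique.filter⁺ (H ⊆?_) (distinct 𝓕))
  (All.zip ( All.map (λ ∣F∣≡k → trans ∣F∣≡k (sym (m+[n∸m]≡n ∣H∣≤k))) (All.filter⁺ (H ⊆?_) uF)
           , All.all-filter (H ⊆?_) (members 𝓕)))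

m+[n∸m+1]≡1+n : ∀ {m n} → m ≤ n → m + (n ∸ m + 1) ≡ suc n
m+[n∸m+1]≡1+n {m} {n} m≤n = begin
  m + (n ∸ m + 1) ≡⟨ +-assoc m (n ∸ m) 1 ⟨
  m + (n ∸ m) + 1 ≡⟨ cong (_+ 1) (m+[n∸m]≡n m≤n) ⟩
  n + 1           ≡⟨ +-comm n 1 ⟩
  suc n           ∎
  where open ≡-Reasoning

module _ {k t M : ℕ} (t≤k : t ≤ k) (𝓕 : Family n) {G H : Subset n}
         (∣G∣≡k : ∣ G ∣ ≡ k) (∣H∩G∣<t : ∣ H ∩ G ∣ < t)
         (bound : ∀ {x} → x ∉ H → sizeContaining 𝓕 (H ∪ ⁅ x ⁆) ≤ M) where

  private
    b = k ∸ t + 1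

    b≤∣G─H∣ : b ≤ ∣ G ─ H ∣
    b≤∣G─H∣ = +-cancelˡ-≤ t b ∣ G ─ H ∣ (begin
      t + b                        ≡⟨ m+[n∸m+1]≡1+n t≤k ⟩
      suc k                        ≡⟨ cong suc (trans (sym ∣G∣≡k) (∣p∣≡∣p∩q∣+∣p─q∣ G H)) ⟩
      suc ∣ G ∩ H ∣ + ∣ G ─ H ∣    ≤⟨ +-monoˡ-≤ ∣ G ─ H ∣ (subst (_< t) (cong ∣_∣ (∩-comm H G)) ∣H∩G∣<t) ⟩
      t + ∣ G ─ H ∣                ∎)
      where open ≤-Reasoning

    S = proj₁ (∃⊆-ofSize (G ─ H) b≤∣G─H∣)
    S⊆G─H = proj₁ (proj₂ (∃⊆-ofSize (G ─ H) b≤∣G─H∣))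
    ∣S∣≡b = proj₂ (proj₂ (∃⊆-ofSize (G ─ H) b≤∣G─H∣))

    ⊇H∧t-meets-G : Pred (Subset n) 0ℓ
    ⊇H∧t-meets-G F = H ⊆ F × ¬ ∣ G ∩ F ∣ < t

    t-disjoint-from-G? : Decidable (λ F → ∣ G ∩ F ∣ < t)
    t-disjoint-from-G? F = ∣ G ∩ F ∣ <? t

    ⊇H∧t-meets-G? : Decidable ⊇H∧t-meets-G
    ⊇H∧t-meets-G? = (H ⊆?_) ∩? ∁? t-disjoint-from-G?

    meets-S : ∀ {F} → ⊇H∧t-meets-G F → Any (_∈ F) (elements S)
    meets-S {F} (_ , ∣G∩F∣≮t) with nonempty? (S ∩ (G ∩ F))
    ... | yes (x , x∈S∩G∩F) =
      let x∈S , x∈G∩F = x∈p∩q⁻ S (G ∩ F) x∈S∩G∩F in Any-elements⁺ x∈S (proj₂ (x∈p∩q⁻ G F x∈G∩F))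
    ... | no  S∩G∩F-empty   = contradiction (begin
      suc k                  ≡⟨ m+[n∸m+1]≡1+n t≤k ⟨
      t + b                  ≡⟨ +-comm t b ⟩
      b + t                  ≤⟨ +-mono-≤ (≤-reflexive (sym ∣S∣≡b)) (≮⇒≥ ∣G∩F∣≮t) ⟩
      ∣ S ∣ + ∣ G ∩ F ∣      ≤⟨ Empty[p∩q]⇒∣p∣+∣q∣≤∣r∣ S (G ∩ F) G (p─q⊆p G H ∘ S⊆G─H) (p∩q⊆p G F) S∩G∩F-empty ⟩
      ∣ G ∣                  ≡⟨ ∣G∣≡k ⟩
      k                      ∎) (n≮n k)
      where open ≤-Reasoning

    containing-x-≤ : ∀ {x} → x ∈ S → length (filter (⊇H∧t-meets-G? ∩? (x ∈?_)) (members 𝓕)) ≤ M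
    containing-x-≤ x∈S = ≤-trans
      (length-filter-mono _ (_ ⊆?_) (λ ((H⊆F , _) , x∈F) → p⊆r∧x∈r⇒p∪⁅x⁆⊆r H⊆F x∈F) (members 𝓕))
      (bound (x∈p─q⇒x∉q G H (S⊆G─H x∈S)))

  sizeContaining-≤-branch : sizeContaining 𝓕 H ≤ numTDisjoint t G 𝓕 + (k ∸ t + 1) * M
  sizeContaining-≤-branch = begin
    sizeContaining 𝓕 H
      ≡⟨ length-filter-split (H ⊆?_) t-disjoint-from-G? (members 𝓕) ⟩
    length (filter ((H ⊆?_) ∩? t-disjoint-from-G?) (members 𝓕)) + length (filter ⊇H∧t-meets-G? (members 𝓕))
      ≤⟨ +-mono-≤ (length-filter-mono _ _ proj₂ (members 𝓕))
                   (length-filter-≤-cover ⊇H∧t-meets-G? _∈?_ (elements S) (members 𝓕) meets-S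
                     (All-elements⁺ S containing-x-≤)) ⟩
    numTDisjoint t G 𝓕 + length (elements S) * M
      ≡⟨ cong (λ m → numTDisjoint t G 𝓕 + m * M) (trans (length-elements S) ∣S∣≡b) ⟩
    numTDisjoint t G 𝓕 + b * M
      ∎
    where open ≤-Reasoning

sum-powers-shift : ∀ s b (g : ℕ → ℕ) m →
  sum (map (λ i → s * b ^ i) (applyUpTo (suc ∘ g) m)) ≡ b * sum (map (λ i → s * b ^ i) (applyUpTo g m))
sum-powers-shift s b g zero    = sym (*-zeroʳ b)
sum-powers-shift s b g (suc m) =
  trans (cong (s * (b * b ^ g 0) +_) (sum-powers-shift s b (g ∘ suc) m)) (factor-b s b (b ^ g 0) _)
  where
    factor-b : ∀ s b x y → s * (b * x) + b * y ≡ b * (s * x + y)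
    factor-b = solve-∀

geomSum-suc : ∀ s b m → geomSum s b (suc m) ≡ s + b * geomSum s b m
geomSum-suc s b m = cong₂ _+_ (*-identityʳ s) (sum-powers-shift s b id m)

module _ {k t s : ℕ} (t≤k : t ≤ k) (𝓕 𝓖 : Family n) (uF : Uniform k 𝓕) (uG : Uniform k 𝓖)
         (cross : All (λ G → numTDisjoint t G 𝓕 ≤ s) (members 𝓖))
         {τ : ℕ} (tau : IsTau t 𝓖 τ) (τ≤k : τ ≤ k) where

  private
    b = k ∸ t + 1
    C₀ = (n ∸ τ) C (k ∸ τ)

  t-disjoint-member : ∀ {H : Subset n} → ∣ H ∣ < τ →
    ∃[ G ] ∣ G ∣ ≡ k × numTDisjoint t G 𝓕 ≤ s × ∣ H ∩ G ∣ < t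
  t-disjoint-member {H} ∣H∣<τ =
    let uncovered = ¬All⇒Any¬ (λ G → t ≤? ∣ H ∩ G ∣) (members 𝓖)
                      (λ H-covers → <⇒≱ ∣H∣<τ (proj₂ tau H H-covers))
        ((∣G∣≡k , few-t-disjoint) , ∣H∩G∣≱t) = All.lookupAny (All.zip (uG , cross)) uncovered
    in Any.lookup uncovered , ∣G∣≡k , few-t-disjoint , ≰⇒> ∣H∩G∣≱t

  sizeContaining-≤-geometric : ∀ d (H : Subset n) → d + ∣ H ∣ ≡ τ →
    sizeContaining 𝓕 H ≤ b ^ d * C₀ + geomSum s b d
  sizeContaining-≤-geometric zero H ∣H∣≡τ = begin
    sizeContaining 𝓕 H              ≤⟨ sizeContaining-≤ 𝓕 uF (subst (_≤ k) (sym ∣H∣≡τ) τ≤k) ⟩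
    (n ∸ ∣ H ∣) C (k ∸ ∣ H ∣)       ≡⟨ cong (λ h → (n ∸ h) C (k ∸ h)) ∣H∣≡τ ⟩
    C₀                              ≡⟨ trans (+-identityʳ (1 * C₀)) (*-identityˡ C₀) ⟨
    1 * C₀ + 0                      ∎
    where open ≤-Reasoning
  sizeContaining-≤-geometric (suc d) H d+1+∣H∣≡τ
    with t-disjoint-member {H} (≤-trans (m≤n+m (suc ∣ H ∣) d) (≤-reflexive (trans (+-suc d ∣ H ∣) d+1+∣H∣≡τ)))
  ... | G , ∣G∣≡k , few-t-disjoint , ∣H∩G∣<t = begin
    sizeContaining 𝓕 H                            ≤⟨ sizeContaining-≤-branch t≤k 𝓕 ∣G∣≡k ∣H∩G∣<t bound ⟩
    numTDisjoint t G 𝓕 + b * M                    ≤⟨ +-monoˡ-≤ (b * M) few-t-disjoint ⟩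
    s + b * M                                     ≡⟨ expand s b (b ^ d) C₀ (geomSum s b d) ⟩
    b * b ^ d * C₀ + (s + b * geomSum s b d)      ≡⟨ cong (b * b ^ d * C₀ +_) (geomSum-suc s b d) ⟨
    b ^ suc d * C₀ + geomSum s b (suc d)          ∎
    where
      open ≤-Reasoning
      M = b ^ d * C₀ + geomSum s b d
      bound : ∀ {x} → x ∉ H → sizeContaining 𝓕 (H ∪ ⁅ x ⁆) ≤ M
      bound {x} x∉H = sizeContaining-≤-geometric d (H ∪ ⁅ x ⁆)
        (trans (cong (d +_) (x∉p⇒∣p∪⁅x⁆∣≡1+∣p∣ H x∉H)) (trans (+-suc d ∣ H ∣) d+1+∣H∣≡τ))
      expand : ∀ s b p c g → s + b * (p * c + g) ≡ b * p * c + (s + b * g)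
      expand = solve-∀

lemma2p2 : (n k t s : ℕ) → 1 ≤ n → 1 ≤ k → 1 ≤ t → 1 ≤ s →
    t + 1 ≤ k → (t + 1) * ((k ∸ t + 1) ^ 2) ≤ n →
    (𝓕 𝓖 : Family n) → Uniform k 𝓕 → Uniform k 𝓖 →
    1 ≤ size 𝓕 → 1 ≤ size 𝓖 →
    AlmostCrossIntersecting s t 𝓕 𝓖 →
    (τ : ℕ) → IsTau t 𝓖 τ → τ ≤ k →
    (H : Subset n) → 1 ≤ ∣ H ∣ → ∣ H ∣ ≤ τ →
    sizeContaining 𝓕 H
      ≤ (k ∸ t + 1) ^ (τ ∸ ∣ H ∣) * ((n ∸ τ) C (k ∸ τ))
        + geomSum s (k ∸ t + 1) (τ ∸ ∣ H ∣)
lemma2p2 n k t s _ _ _ _ t+1≤k _ 𝓕 𝓖 uF uG _ _ (_ , cross) τ tau τ≤k H _ ∣H∣≤τ =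
  sizeContaining-≤-geometric (≤-trans (m≤m+n t 1) t+1≤k) 𝓕 𝓖 uF uG cross tau τ≤k (τ ∸ ∣ H ∣) H (m∸n+n≡m ∣H∣≤τ)
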